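{- Let $n>1$ and $n=rs$ with $r,s\ge1$, and let $\mathcal{C}\subseteq S_n$ be the conjugacy class of permutations of cycle type $(r^s)$. Then Cellini's cyclic descent map on $\mathcal{C}$ is not closed under cyclic rotation modulo $n$; that is, there is no bijection $p:\mathcal{C}\to\mathcal{C}$ with $\mathrm{CDes}(p(\pi))=\mathrm{sh}(\mathrm{CDes}(\pi))$ for all $\pi\in\mathcal{C}$.
   Context: For $\pi=[\pi_1,\dots,\pi_n]\in S_n$ in one-line notation, Cellini's cyclic descent set is $\mathrm{CDes}(\pi)=\{1\le i\le n:\pi_i>\pi_{i+1}\}$ with the convention $\pi_{n+1}=\pi_1$. $\mathrm{sh}:2^{[n]}\to2^{[n]}$ is the bijection induced by $i\mapsto i+1\pmod n$. -}

module Defs where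

open import Data.Nat using (ℕ; zero; suc; _<_; _<ᵇ_; _%_)
open import Data.Nat.DivMod using (m%n<n)
open import Data.Fin using (Fin; toℕ; fromℕ<)
import Data.Fin.Properties as FinP
open import Data.Fin.Subset using (Subset)
open import Data.Bool using (Bool; true; false)
import Data.Bool.Properties as BoolP
open import Data.Vec using (Vec; lookup; tabulate)
open import Data.Product using (_×_)
open import Function using (_∘_; id)
open import Relation.Binary.PropositionalEquality using (_≡_; _≢_)
open import Relation.Nullary.Decidable using (⌊_⌋; _×-dec_)

-- Convention: [n] = {1,…,n} is represented by Fin n, index i standing for i+1.
-- A permutation in one-line notation: a vector π = [π₁,…,πₙ] of entries in
-- [n] which is injective (hence a bijection of [n]).
IsPerm : ∀ {n} → Vec (Fin n) n → Set
IsPerm π = ∀ i j → lookup π i ≡ lookup π j → i ≡ j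

csuc : ∀ {n} → Fin n → Fin n
csuc {suc m} i = fromℕ< (m%n<n (suc (toℕ i)) (suc m))

iter : ∀ {A : Set} → (A → A) → ℕ → A → A
iter f zero    = id
iter f (suc k) = f ∘ iter f k

HasCycleType : ∀ {n} → ℕ → Vec (Fin n) n → Set
HasCycleType r π =
  ∀ i → (iter (lookup π) r i ≡ i) × (∀ k → 0 < k → k < r → iter (lookup π) k i ≢ i)

InClass : ∀ {n} → ℕ → Vec (Fin n) n → Set
InClass r π = IsPerm π × HasCycleType r π

CDes : ∀ {n} → Vec (Fin n) n → Subset n
CDes π = tabulate λ i → toℕ (lookup π (csuc i)) <ᵇ toℕ (lookup π i)

sh : ∀ {n} → Subset n → Subset n
sh S = tabulate λ j →
  ⌊ FinP.any? (λ i → (lookup S i BoolP.≟ true) ×-dec (csuc i FinP.≟ j)) ⌋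

module Submission where

-- Write n = m + 1 and index positions by Fin n, so that the last
-- position is 'fromℕ m'.  Suppose p maps the class 𝒞 of cycle type (r^s) into
-- itself and satisfies CDes (p π) = sh (CDes π).  Then p moves a one-point
-- cyclic descent set {t} to {t+1}; iterating p moves it anywhere.
--
--  * A permutation σ commuting with i ↦ i+1 (mod n) descends exactly where
--    σ i is the last value, so its cyclic descent set is a single point.  The
--    rotation ρ i = i + s (mod n) is such a permutation, and it lies in 𝒞.
--  * If r ≥ 2, s ≤ m and the descent of ρ sits at the t with t + s = m.
--    Applying p s times yields τ ∈ 𝒞 whose only descent is the last
--    position; τ is then increasing, so τ fixes 0, contradicting that every
--    cycle of τ has length r ≥ 2.
--  * If r = 1, 𝒞 = {id}, whose descent set is {m}; applying p once gives a
--    member of 𝒞 with descent set {0} ≠ {m}.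

open import Defs
open import Data.Nat
open import Data.Nat.Properties
open import Data.Nat.DivMod
open import Data.Nat.Divisibility using (_∣_; divides; ∣⇒≤)
open import Data.Fin using (Fin; toℕ; fromℕ; fromℕ<) renaming (zero to fzero)
import Data.Fin.Properties as FinP
open import Data.Fin.Subset using (Subset)
open import Data.Bool using (true)
import Data.Bool as Bool
open import Data.Bool.Properties using (T-≡)
open import Data.Vec using (Vec; lookup; tabulate)
open import Data.Vec.Properties using (lookup∘tabulate)
open import Data.Product using (Σ; ∃; _×_; _,_; proj₁; proj₂)
open import Data.Sum using (inj₁; inj₂)
open import Function.Base using (_∘′_)
open import Function.Bundles using (Equivalence)
open import Relation.Nullary using (¬_; Dec; contradiction)
open import Relation.Nullary.Decidable using (toWitness; dec-true; isYes≗does; _×-dec_)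
open import Relation.Binary.PropositionalEquality

iter-commute : ∀ {A : Set} (f : A → A) k x → iter f k (f x) ≡ f (iter f k x)
iter-commute f zero    x = refl
iter-commute f (suc k) x = cong f (iter-commute f k x)

iter-+ : ∀ {A : Set} (f : A → A) a b x → iter f (a + b) x ≡ iter f a (iter f b x)
iter-+ f zero    b x = refl
iter-+ f (suc a) b x = cong f (iter-+ f a b x)

-- a map with a period r ≥ 1 is injective: its (r-1)-st iterate inverts it
periodic⇒injective : ∀ {A : Set} (f : A → A) r → 1 ≤ r → (∀ x → iter f r x ≡ x) →
  ∀ x y → f x ≡ f y → x ≡ y
periodic⇒injective f (suc r) _ period x y fx≡fy = begin
  x                   ≡⟨ sym (period x) ⟩
  f (iter f r x)      ≡⟨ sym (iter-commute f r x) ⟩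
  iter f r (f x)      ≡⟨ cong (iter f r) fx≡fy ⟩
  iter f r (f y)      ≡⟨ iter-commute f r y ⟩
  f (iter f r y)      ≡⟨ period y ⟩
  y                   ∎
  where open ≡-Reasoning

suc-% : ∀ a N .{{_ : NonZero N}} → suc (a % N) % N ≡ suc a % N
suc-% a N = begin
  (1 + a % N) % N           ≡⟨ %-distribˡ-+ 1 (a % N) N ⟩
  (1 % N + a % N % N) % N   ≡⟨ cong (λ z → (1 % N + z) % N) (m%n%n≡m%n a N) ⟩
  (1 % N + a % N) % N       ≡⟨ sym (%-distribˡ-+ 1 a N) ⟩
  (1 + a) % N               ∎
  where open ≡-Reasoning

iter-csuc-val : ∀ {m} k (x : Fin (suc m)) → toℕ (iter csuc k x) ≡ (toℕ x + k) % suc m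
iter-csuc-val {m} zero x = begin
  toℕ x                ≡⟨ sym (m<n⇒m%n≡m (FinP.toℕ<n x)) ⟩
  toℕ x % suc m        ≡⟨ cong (_% suc m) (sym (+-identityʳ (toℕ x))) ⟩
  (toℕ x + 0) % suc m  ∎
  where open ≡-Reasoning
iter-csuc-val {m} (suc k) x = begin
  toℕ (csuc (iter csuc k x))          ≡⟨ FinP.toℕ-fromℕ< _ ⟩
  suc (toℕ (iter csuc k x)) % suc m   ≡⟨ cong (λ z → suc z % suc m) (iter-csuc-val k x) ⟩
  suc ((toℕ x + k) % suc m) % suc m   ≡⟨ suc-% (toℕ x + k) (suc m) ⟩
  suc (toℕ x + k) % suc m             ≡⟨ cong (_% suc m) (sym (+-suc (toℕ x) k)) ⟩
  (toℕ x + suc k) % suc m             ∎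
  where open ≡-Reasoning

csuc-last : ∀ m → toℕ (csuc (fromℕ m)) ≡ 0
csuc-last m = begin
  toℕ (csuc (fromℕ m))          ≡⟨ FinP.toℕ-fromℕ< _ ⟩
  suc (toℕ (fromℕ m)) % suc m   ≡⟨ cong (λ z → suc z % suc m) (FinP.toℕ-fromℕ m) ⟩
  suc m % suc m                 ≡⟨ n%n≡0 (suc m) ⟩
  0                             ∎
  where open ≡-Reasoning

csuc-below-last : ∀ {m} (i : Fin (suc m)) → toℕ i < m → toℕ (csuc i) ≡ suc (toℕ i)
csuc-below-last {m} i i<m = trans (FinP.toℕ-fromℕ< _) (m<n⇒m%n≡m (s≤s i<m))

csuc-decreases⇒last : ∀ {m} (i : Fin (suc m)) → toℕ (csuc i) < toℕ i → i ≡ fromℕ m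
csuc-decreases⇒last {m} i dec with m≤n⇒m<n∨m≡n (≤-pred (FinP.toℕ<n i))
... | inj₁ i<m = contradiction (subst (_< toℕ i) (csuc-below-last i i<m) dec) (<-asym (n<1+n (toℕ i)))
... | inj₂ i≡m = FinP.toℕ-injective (trans i≡m (sym (FinP.toℕ-fromℕ m)))

%-fixed⇒∣ : ∀ x d N .{{_ : NonZero N}} → (x + d) % N ≡ x → N ∣ d
%-fixed⇒∣ x d N fixed = divides ((x + d) / N) (+-cancelˡ-≡ x d _ (begin
  x + d                              ≡⟨ m≡m%n+[m/n]*n (x + d) N ⟩
  (x + d) % N + (x + d) / N * N      ≡⟨ cong (_+ (x + d) / N * N) fixed ⟩
  x + (x + d) / N * N                ∎))
  where open ≡-Reasoning

descent⇒ : ∀ {n} (σ : Vec (Fin n) n) i → lookup (CDes σ) i ≡ true →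
  toℕ (lookup σ (csuc i)) < toℕ (lookup σ i)
descent⇒ σ i isDescent =
  <ᵇ⇒< _ _ (Equivalence.from T-≡ (trans (sym (lookup∘tabulate _ i)) isDescent))

⇒descent : ∀ {n} (σ : Vec (Fin n) n) i → toℕ (lookup σ (csuc i)) < toℕ (lookup σ i) →
  lookup (CDes σ) i ≡ true
⇒descent σ i drop = trans (lookup∘tabulate _ i) (Equivalence.to T-≡ (<⇒<ᵇ drop))

ascent⇒ : ∀ {n} (σ : Vec (Fin n) n) → IsPerm σ → ∀ i → csuc i ≢ i →
  lookup (CDes σ) i ≢ true → toℕ (lookup σ i) < toℕ (lookup σ (csuc i))
ascent⇒ σ perm i moves noDescent = ≤∧≢⇒< (≮⇒≥ (noDescent ∘′ ⇒descent σ i))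
  (λ same → moves (sym (perm i (csuc i) (FinP.toℕ-injective same))))

IsSingleton : ∀ {n} → Subset n → Fin n → Set
IsSingleton S t = (∀ i → lookup S i ≡ true → i ≡ t) × lookup S t ≡ true

singleton-unique : ∀ {n} {S : Subset n} {t u} → IsSingleton S t → IsSingleton S u → t ≡ u
singleton-unique (onlyT , _) (_ , hasU) = sym (onlyT _ hasU)

sh-singleton : ∀ {n} (S : Subset n) t → IsSingleton S t → IsSingleton (sh S) (csuc t)
sh-singleton S t (onlyT , hasT) = onlyImage , hasImage
  where
  onlyImage : ∀ j → lookup (sh S) j ≡ true → j ≡ csuc t
  onlyImage j inShS with toWitness (Equivalence.from T-≡ (trans (sym (lookup∘tabulate _ j)) inShS))
  ... | i , inS , csuc-i≡j = trans (sym csuc-i≡j) (cong csuc (onlyT i inS))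
  hasImage : lookup (sh S) (csuc t) ≡ true
  hasImage = trans (lookup∘tabulate _ (csuc t))
    (trans (isYes≗does (hitBy? (csuc t))) (dec-true (hitBy? (csuc t)) (t , hasT , refl)))
    where
    -- the decision procedure used in the definition of sh
    hitBy? : ∀ j → Dec (∃ λ i → lookup S i ≡ true × csuc i ≡ j)
    hitBy? j = FinP.any? (λ i → (lookup S i Bool.≟ true) ×-dec (csuc i FinP.≟ j))

-- A permutation commuting with the cyclic successor descends exactly where it
-- takes the last value: there σ (i+1) = σ i + 1 wraps around to 0.
commuting-singleton : ∀ {m} (σ : Vec (Fin (suc m)) (suc m)) → IsPerm σ →
  (∀ i → lookup σ (csuc i) ≡ csuc (lookup σ i)) →
  0 < m → ∀ t → lookup σ t ≡ fromℕ m → IsSingleton (CDes σ) t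
commuting-singleton {m} σ perm commutes 0<m t σt≡last = onlyT , hasT
  where
  onlyT : ∀ i → lookup (CDes σ) i ≡ true → i ≡ t
  onlyT i isDescent = perm i t (trans (csuc-decreases⇒last (lookup σ i) wraps) (sym σt≡last))
    where
    wraps : toℕ (csuc (lookup σ i)) < toℕ (lookup σ i)
    wraps = subst (λ x → toℕ x < toℕ (lookup σ i)) (commutes i) (descent⇒ σ i isDescent)
  hasT : lookup (CDes σ) t ≡ true
  hasT = ⇒descent σ t (subst₂ _<_ (sym wrapsToZero) (sym atLast) 0<m)
    where
    atLast : toℕ (lookup σ t) ≡ m
    atLast = trans (cong toℕ σt≡last) (FinP.toℕ-fromℕ m)
    wrapsToZero : toℕ (lookup σ (csuc t)) ≡ 0
    wrapsToZero = trans (cong toℕ (trans (commutes t) (cong csuc σt≡last))) (csuc-last m)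

-- This is where injectivity turns ascents into strict ones.
ascending-run : ∀ {m} (σ : Vec (Fin (suc m)) (suc m)) → IsPerm σ →
  (∀ i → lookup (CDes σ) i ≡ true → i ≡ fromℕ m) →
  ∀ k → k ≤ m → toℕ (lookup σ fzero) + k ≤ toℕ (lookup σ (iter csuc k fzero))
ascending-run σ perm onlyLast zero    _   = ≤-reflexive (+-identityʳ _)
ascending-run {m} σ perm onlyLast (suc k) k<m = begin
  toℕ (lookup σ fzero) + suc k          ≡⟨ +-suc _ k ⟩
  suc (toℕ (lookup σ fzero) + k)        ≤⟨ s≤s (ascending-run σ perm onlyLast k (<⇒≤ k<m)) ⟩
  suc (toℕ (lookup σ i))                ≤⟨ ascent⇒ σ perm i moves noDescent ⟩
  toℕ (lookup σ (csuc i))               ∎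
  where
  open ≤-Reasoning
  i : Fin (suc m)
  i = iter csuc k fzero
  i≡k : toℕ i ≡ k
  i≡k = trans (iter-csuc-val k fzero) (m<n⇒m%n≡m (<-trans k<m (n<1+n m)))
  i<m : toℕ i < m
  i<m = subst (_< m) (sym i≡k) k<m
  moves : csuc i ≢ i
  moves same = 1+n≢n (trans (sym (csuc-below-last i i<m)) (cong toℕ same))
  noDescent : lookup (CDes σ) i ≢ true
  noDescent isDescent = <-irrefl (trans (cong toℕ (onlyLast i isDescent)) (FinP.toℕ-fromℕ m)) i<m

-- Taking k = m, with σ m ≤ m, such a permutation fixes the first position.
last-descent⇒fixes-first : ∀ {m} (σ : Vec (Fin (suc m)) (suc m)) → IsPerm σ →
  (∀ i → lookup (CDes σ) i ≡ true → i ≡ fromℕ m) → lookup σ fzero ≡ fzero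
last-descent⇒fixes-first {m} σ perm onlyLast = FinP.toℕ-injective (n≤0⇒n≡0 (+-cancelʳ-≤ m _ 0 (begin
  toℕ (lookup σ fzero) + m             ≤⟨ ascending-run σ perm onlyLast m ≤-refl ⟩
  toℕ (lookup σ (iter csuc m fzero))   ≤⟨ ≤-pred (FinP.toℕ<n _) ⟩
  m                                    ∎)))
  where open ≤-Reasoning

-- p maps the class of cycle type (r^s) into itself and rotates cyclic
-- descent sets (the part of the hypothesis of the theorem that is used)
DescentRotating : ℕ → ∀ n → (Vec (Fin n) n → Vec (Fin n) n) → Set
DescentRotating r n p =
    ((π : Vec (Fin n) n) → InClass r π → InClass r (p π))
  × ((π : Vec (Fin n) n) → InClass r π → CDes (p π) ≡ sh (CDes π))

transport : ∀ {r n p} → DescentRotating r n p → ∀ k {σ : Vec (Fin n) n} {t} →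
  InClass r σ → IsSingleton (CDes σ) t →
  InClass r (iter p k σ) × IsSingleton (CDes (iter p k σ)) (iter csuc k t)
transport rotating zero    σ∈𝒞 single = σ∈𝒞 , single
transport {r} {n} {p} (preserves , rotates) (suc k) {σ} {t} σ∈𝒞 single =
  preserves τ τ∈𝒞 ,
  subst (λ S → IsSingleton S (iter csuc (suc k) t)) (sym (rotates τ τ∈𝒞))
        (sh-singleton (CDes τ) (iter csuc k t) τ-single)
  where
  τ : Vec (Fin n) n
  τ = iter p k σ
  previous : InClass r τ × IsSingleton (CDes τ) (iter csuc k t)
  previous = transport (preserves , rotates) k σ∈𝒞 single
  τ∈𝒞 : InClass r τ
  τ∈𝒞 = proj₁ previous
  τ-single : IsSingleton (CDes τ) (iter csuc k t)
  τ-single = proj₂ previous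

module Rotation (r s m : ℕ) (rs≡n : r * s ≡ suc m) (1≤r : 1 ≤ r) (1≤s : 1 ≤ s) where

  ρ : Vec (Fin (suc m)) (suc m)
  ρ = tabulate (iter csuc s)

  -- ρ commutes with the cyclic successor, as both are powers of it
  ρ-commutes : ∀ i → lookup ρ (csuc i) ≡ csuc (lookup ρ i)
  ρ-commutes i = begin
    lookup ρ (csuc i)           ≡⟨ lookup∘tabulate (iter csuc s) (csuc i) ⟩
    iter csuc s (csuc i)        ≡⟨ iter-commute csuc s i ⟩
    csuc (iter csuc s i)        ≡⟨ cong csuc (sym (lookup∘tabulate (iter csuc s) i)) ⟩
    csuc (lookup ρ i)           ∎
    where open ≡-Reasoning

  ρ-powers : ∀ k x → iter (lookup ρ) k x ≡ iter csuc (k * s) x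
  ρ-powers zero    x = refl
  ρ-powers (suc k) x = begin
    lookup ρ (iter (lookup ρ) k x)     ≡⟨ lookup∘tabulate (iter csuc s) _ ⟩
    iter csuc s (iter (lookup ρ) k x)  ≡⟨ cong (iter csuc s) (ρ-powers k x) ⟩
    iter csuc s (iter csuc (k * s) x)  ≡⟨ sym (iter-+ csuc s (k * s) x) ⟩
    iter csuc (s + k * s) x            ∎
    where open ≡-Reasoning

  -- ρ^r moves every point by r s = n, i.e. not at all
  ρ-period : ∀ x → iter (lookup ρ) r x ≡ x
  ρ-period x = FinP.toℕ-injective (begin
    toℕ (iter (lookup ρ) r x)     ≡⟨ cong toℕ (ρ-powers r x) ⟩
    toℕ (iter csuc (r * s) x)     ≡⟨ iter-csuc-val (r * s) x ⟩
    (toℕ x + r * s) % suc m       ≡⟨ cong (λ d → (toℕ x + d) % suc m) rs≡n ⟩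
    (toℕ x + suc m) % suc m       ≡⟨ [m+n]%n≡m%n (toℕ x) (suc m) ⟩
    toℕ x % suc m                 ≡⟨ m<n⇒m%n≡m (FinP.toℕ<n x) ⟩
    toℕ x                         ∎)
    where open ≡-Reasoning

  -- for 0 < k < r, ρ^k moves every point by k s, which is not a multiple of n
  ρ-aperiodic : ∀ k → 0 < k → k < r → ∀ x → iter (lookup ρ) k x ≢ x
  ρ-aperiodic k 0<k k<r x fixed = <⇒≱ ks<n (∣⇒≤ {{>-nonZero 0<ks}} n∣ks)
    where
    0<ks : 0 < k * s
    0<ks = *-mono-≤ 0<k 1≤s
    ks<n : k * s < suc m
    ks<n = subst (k * s <_) rs≡n (*-monoˡ-< s {{>-nonZero 1≤s}} k<r)
    n∣ks : suc m ∣ k * s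
    n∣ks = %-fixed⇒∣ (toℕ x) (k * s) (suc m)
      (trans (sym (iter-csuc-val (k * s) x)) (cong toℕ (trans (sym (ρ-powers k x)) fixed)))

  -- ρ is a permutation: it has period r
  ρ-perm : IsPerm ρ
  ρ-perm = periodic⇒injective (lookup ρ) r 1≤r ρ-period

  ρ∈𝒞 : InClass r ρ
  ρ∈𝒞 = ρ-perm , λ x → ρ-period x , λ k 0<k k<r → ρ-aperiodic k 0<k k<r x

  -- for s ≤ m the point start = m - s is sent to the last position by ρ,
  -- so it is the only cyclic descent of ρ
  module _ (s≤m : s ≤ m) where

    start<n : m ∸ s < suc m
    start<n = s≤s (m∸n≤m m s)

    start : Fin (suc m)
    start = fromℕ< start<n

    start-reaches-last : iter csuc s start ≡ fromℕ m
    start-reaches-last = FinP.toℕ-injective (begin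
      toℕ (iter csuc s start)     ≡⟨ iter-csuc-val s start ⟩
      (toℕ start + s) % suc m     ≡⟨ cong (λ y → (y + s) % suc m) (FinP.toℕ-fromℕ< start<n) ⟩
      (m ∸ s + s) % suc m         ≡⟨ cong (_% suc m) (m∸n+n≡m s≤m) ⟩
      m % suc m                   ≡⟨ m<n⇒m%n≡m (n<1+n m) ⟩
      m                           ≡⟨ sym (FinP.toℕ-fromℕ m) ⟩
      toℕ (fromℕ m)               ∎)
      where open ≡-Reasoning

    ρ-singleton : IsSingleton (CDes ρ) start
    ρ-singleton = commuting-singleton ρ ρ-perm ρ-commutes (≤-trans 1≤s s≤m) start
      (trans (lookup∘tabulate (iter csuc s) start) start-reaches-last)

-- The class of cycle type (1^n) is {id}, whose only descent is the last position.
class-one-singleton : ∀ {m} (σ : Vec (Fin (suc m)) (suc m)) → 0 < m → InClass 1 σ →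
  IsSingleton (CDes σ) (fromℕ m)
class-one-singleton σ 0<m (perm , cycles) =
  commuting-singleton σ perm (λ i → trans (fixes (csuc i)) (cong csuc (sym (fixes i)))) 0<m _ (fixes _)
  where
  fixes : ∀ i → lookup σ i ≡ i
  fixes i = proj₁ (cycles i)

cofactor≤ : ∀ {r s m} → 2 ≤ r → 1 ≤ s → r * s ≡ suc m → s ≤ m
cofactor≤ {r} {s} 2≤r 1≤s rs≡n = ≤-pred (begin-strict
  s       <⟨ m<m*n s r {{>-nonZero 1≤s}} 2≤r ⟩
  s * r   ≡⟨ *-comm s r ⟩
  r * s   ≡⟨ rs≡n ⟩
  _       ∎)
  where open ≤-Reasoning

no-descent-rotating-map : ∀ {r s n} → r * s ≡ n → 1 ≤ r → 1 ≤ s → 1 < n →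
  ¬ Σ (Vec (Fin n) n → Vec (Fin n) n) (DescentRotating r n)
no-descent-rotating-map {suc zero} {s} {suc m} rs≡n 1≤r 1≤s (s≤s 0<m) (p , rotating) =
  <⇒≢ 0<m (begin
    0                       ≡⟨ sym (csuc-last m) ⟩
    toℕ (csuc (fromℕ m))    ≡⟨ cong toℕ wraps ⟩
    toℕ (fromℕ m)           ≡⟨ FinP.toℕ-fromℕ m ⟩
    m                       ∎)
  where
  open Rotation 1 s m rs≡n 1≤r 1≤s
  open ≡-Reasoning
  -- p ρ has descent set {m} as a member of the class, and {m+1} = {0} by rotation
  wraps : csuc (fromℕ m) ≡ fromℕ m
  wraps = singleton-unique {S = CDes (p ρ)}
    (proj₂ (transport {p = p} rotating 1 ρ∈𝒞 (class-one-singleton ρ 0<m ρ∈𝒞)))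
    (class-one-singleton (p ρ) 0<m (proj₁ rotating ρ ρ∈𝒞))
no-descent-rotating-map {suc (suc r)} {s} {suc m} rs≡n 1≤r 1≤s _ (p , rotating) =
  proj₂ (proj₂ (proj₁ τ-facts) fzero) 1 (s≤s z≤n) (s≤s (s≤s z≤n)) τ-fixes-first
  where
  open Rotation (suc (suc r)) s m rs≡n 1≤r 1≤s
  s≤m : s ≤ m
  s≤m = cofactor≤ {suc (suc r)} (s≤s (s≤s z≤n)) 1≤s rs≡n
  -- after s rotations the unique descent of ρ has moved to the last position
  τ : Vec (Fin (suc m)) (suc m)
  τ = iter p s ρ
  τ-facts : InClass (suc (suc r)) τ × IsSingleton (CDes τ) (iter csuc s (start s≤m))
  τ-facts = transport rotating s ρ∈𝒞 (ρ-singleton s≤m)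
  τ-onlyLast : ∀ i → lookup (CDes τ) i ≡ true → i ≡ fromℕ m
  τ-onlyLast i isDescent = trans (proj₁ (proj₂ τ-facts) i isDescent) (start-reaches-last s≤m)
  -- so τ is increasing and fixes 0, while its cycles have length r ≥ 2
  τ-fixes-first : lookup τ fzero ≡ fzero
  τ-fixes-first = last-descent⇒fixes-first τ (proj₁ (proj₁ τ-facts)) τ-onlyLast

proposition6p7 : (r s : ℕ) → 1 ≤ r → 1 ≤ s → 1 < r * s →
    ¬ (Σ (Vec (Fin (r * s)) (r * s) → Vec (Fin (r * s)) (r * s)) λ p →
        ((π : Vec (Fin (r * s)) (r * s)) → InClass r π → InClass r (p π))
      × ((π σ : Vec (Fin (r * s)) (r * s)) → InClass r π → InClass r σ → p π ≡ p σ → π ≡ σ)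
      × ((σ : Vec (Fin (r * s)) (r * s)) → InClass r σ → Σ (Vec (Fin (r * s)) (r * s)) λ π → InClass r π × p π ≡ σ)
      × ((π : Vec (Fin (r * s)) (r * s)) → InClass r π → CDes (p π) ≡ sh (CDes π)))
proposition6p7 r s 1≤r 1≤s 1<n (p , preserves , _ , _ , rotates) =
  no-descent-rotating-map refl 1≤r 1≤s 1<n (p , preserves , rotates)
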